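{- Let $n\ge 1$ be an integer. The Kneser graph $K(2n,2)$ contains the $k$-th power of a Hamiltonian cycle for each integer $k$ with $1\le k\le n-2$.
   Context: The Kneser graph $K(m,s)$ has vertex set $\binom{[m]}{s}$ (all $s$-element subsets of $[m]=\{1,\dots,m\}$), with $A$ and $B$ adjacent if and only if $A\cap B=\emptyset$. A graph $G$ on $N$ vertices contains the $k$-th power of a Hamiltonian cycle if there is a cyclic ordering $(v_1,\dots,v_N)$ of all its vertices such that for all $i,j\in[N]$ with $i<j$ and $\min\{j-i,\ i+N-j\}\le k$, the vertices $v_i$ and $v_j$ are adjacent in $G$. -}

module Defs where

open import Data.Nat using (ℕ; _≤_; _∸_; _+_; _⊓_)
open import Data.Fin using (Fin; toℕ; _<_)
open import Data.Fin.Subset using (Subset; ∣_∣; _∩_; Empty)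
open import Data.Product using (Σ; ∃-syntax; proj₁)
open import Function.Bundles using (_⤖_; Bijection)
open import Relation.Binary.PropositionalEquality using (_≡_)

KneserVertex : ℕ → ℕ → Set
KneserVertex m s = Σ (Subset m) (λ A → ∣ A ∣ ≡ s)

KneserAdj : ∀ {m s} → KneserVertex m s → KneserVertex m s → Set
KneserAdj A B = Empty (proj₁ A ∩ proj₁ B)

ContainsHamCyclePower : (V : Set) → (V → V → Set) → ℕ → Set
ContainsHamCyclePower V Adj k =
  ∃[ N ] Σ (Fin N ⤖ V) λ v →
    ∀ (i j : Fin N) → i < j →
      ((toℕ j ∸ toℕ i) ⊓ (toℕ i + N ∸ toℕ j)) ≤ k →
      Adj (Bijection.to v i) (Bijection.to v j)

-- Write M = 2n − 1 and identify [2n] with ℤ_M ∪ {∞}. For i ∈ ℤ_M the edges {i, ∞} and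
-- {i + p, i − p} (1 ≤ p ≤ n − 1) of K_{2n} form a perfect matching F_i, and F_0, …, F_{M−1}
-- partition the 2-subsets: a finite edge {a, b} lies in F_i exactly when a + b ≡ 2i, and 2 is
-- invertible modulo the odd number M. List the matchings in the order F_0, F_1, …, each one as
-- p = 0, 1, …, n − 1. Two entries at cyclic distance at most n − 2 are either in the same
-- matching, hence disjoint, or are the p-th edge of F_i and the q-th edge of F_{i+1} with
-- p ≥ q + 2; then every difference between an endpoint of one and an endpoint of the other is
-- nonzero and smaller than M in absolute value, so these edges are disjoint as well.

module Submission where

open import Defs
open import Data.Nat using (ℕ; zero; suc; z≤n; s≤s; _≤_; _<_; NonZero)
import Data.Nat.Base as ℕ
import Data.Nat.Properties as ℕ
open import Data.Nat.Divisibility using (n∣m*n)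
open import Data.Nat.DivMod using (_/_; _%_; m≡m%n+[m/n]*n; m%n<n; [m+kn]%n≡m%n; m<n⇒m%n≡m; +-distrib-/-∣ʳ; m<n⇒m/n≡0; m*n/n≡m; m<n*o⇒m/o<n)
import Data.Nat.Tactic.RingSolver as ℕ-Solver
open import Data.Integer.Base as ℤ using (ℤ; +_; _%ℕ_; _/ℕ_)
open import Data.Integer.Properties using (abs-*; +-injective; i-j≡0⇒i≡j; ∣i∣≡0⇒i≡0; m-n≡m⊖n; ∣m⊝n∣≤m⊔n)
open import Data.Integer.DivMod using (a≡a%ℕn+[a/ℕn]*n; n%ℕd<d)
import Data.Integer.Tactic.RingSolver as ℤ-Solver
open import Data.Fin using (Fin; zero; suc; toℕ; fromℕ<; _↑ˡ_; _↑ʳ_; splitAt; punchOut)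
open import Data.Fin.Properties using (toℕ<n; toℕ-injective; toℕ-fromℕ<; fromℕ<-injective; fromℕ<-cong; ↑ˡ-injective; ↑ʳ-injective; splitAt-↑ˡ; splitAt-↑ʳ; any?; _≟_; punchOut-injective; injective⇒≤)
open import Data.Fin.Subset using (inside; outside; ⁅_⁆; _∪_; _∈_; ∣_∣; Empty)
open import Data.Fin.Subset.Properties using (∣⁅x⁆∣≡1; ∪-identityˡ; ∪-identityʳ; x∈⁅x⁆; x∈⁅y⁆⇒x≡y; x∈p∪q⁺; x∈p∪q⁻; x∈p∩q⁻; ∩-comm)
open import Data.Product using (∃; _×_; _,_; proj₁; proj₂)
open import Data.Sum using (_⊎_; inj₁; inj₂)
open import Function using (_∘_)
open import Function.Bundles using (_↣_; _⤖_; Injection; mk↣; mk⤖)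
open import Function.Definitions using (Injective; StrictlySurjective)
open import Relation.Nullary using (¬_; Dec; yes; no; contradiction)
open import Relation.Binary.Definitions using (Tri; tri<; tri≈; tri>)
open import Relation.Binary.PropositionalEquality

module Congruence where
  open import Data.Integer.Base using (_+_; _-_; _*_; -_)
  open import Data.List using (_∷_; [])
  open ℤ-Solver using (solve)
  open ≡-Reasoning

  infix 4 _≡_[mod_]

  record _≡_[mod_] (x y m : ℤ) : Set where
    constructor _,_
    field
      quotient  : ℤ
      x-y≡qm    : x - y ≡ quotient * m

  module _ {m : ℤ} where

    mod-refl : ∀ x → x ≡ x [mod m ]
    mod-refl x = + 0 , solve (x ∷ m ∷ [])

    mod-reflexive : ∀ {x y} → x ≡ y → x ≡ y [mod m ]
    mod-reflexive {x} refl = mod-refl x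

    mod-sym : ∀ {x y} → x ≡ y [mod m ] → y ≡ x [mod m ]
    mod-sym {x} {y} (k , x-y≡km) = - k , (begin
      y - x     ≡⟨ solve (x ∷ y ∷ []) ⟩
      - (x - y) ≡⟨ cong -_ x-y≡km ⟩
      - (k * m) ≡⟨ solve (k ∷ m ∷ []) ⟩
      - k * m   ∎)

    mod-trans : ∀ {x y z} → x ≡ y [mod m ] → y ≡ z [mod m ] → x ≡ z [mod m ]
    mod-trans {x} {y} {z} (k , x-y≡km) (l , y-z≡lm) = k + l , (begin
      x - z             ≡⟨ solve (x ∷ y ∷ z ∷ []) ⟩
      (x - y) + (y - z) ≡⟨ cong₂ _+_ x-y≡km y-z≡lm ⟩
      k * m + l * m     ≡⟨ solve (k ∷ l ∷ m ∷ []) ⟩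
      (k + l) * m       ∎)

    mod-+ : ∀ {x y x' y'} → x ≡ y [mod m ] → x' ≡ y' [mod m ] → x + x' ≡ y + y' [mod m ]
    mod-+ {x} {y} {x'} {y'} (k , x-y≡km) (l , x'-y'≡lm) = k + l , (begin
      (x + x') - (y + y') ≡⟨ solve (x ∷ y ∷ x' ∷ y' ∷ []) ⟩
      (x - y) + (x' - y') ≡⟨ cong₂ _+_ x-y≡km x'-y'≡lm ⟩
      k * m + l * m       ≡⟨ solve (k ∷ l ∷ m ∷ []) ⟩
      (k + l) * m         ∎)

    +-multiple-mod : ∀ x q → x + q * m ≡ x [mod m ]
    +-multiple-mod x q = q , solve (x ∷ q ∷ m ∷ [])

    +m-mod : ∀ x → x + m ≡ x [mod m ]
    +m-mod x = + 1 , solve (x ∷ m ∷ [])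

    +-cancel-mod : ∀ x {y} → x + y ≡ x [mod m ] → y ≡ + 0 [mod m ]
    +-cancel-mod x {y} (k , eq) = k , (begin
      y - + 0       ≡⟨ solve (x ∷ y ∷ []) ⟩
      (x + y) - x   ≡⟨ eq ⟩
      k * m         ∎)

  -- Multiplying by 1 + ρ inverts 2 modulo the odd number 1 + 2ρ.
  halve-mod : ∀ ρ {x y} → x + x ≡ y + y [mod + 1 + ρ + ρ ] → x ≡ y [mod + 1 + ρ + ρ ]
  halve-mod ρ {x} {y} (k , eq) = (+ 1 + ρ) * k - (x - y) , (begin
    x - y                                                  ≡⟨ solve (ρ ∷ x ∷ y ∷ []) ⟩
    (+ 1 + ρ) * ((x + x) - (y + y)) - (x - y) * (+ 1 + ρ + ρ)
      ≡⟨ cong (λ z → (+ 1 + ρ) * z - (x - y) * (+ 1 + ρ + ρ)) eq ⟩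
    (+ 1 + ρ) * (k * (+ 1 + ρ + ρ)) - (x - y) * (+ 1 + ρ + ρ) ≡⟨ solve (ρ ∷ k ∷ x ∷ y ∷ []) ⟩
    ((+ 1 + ρ) * k - (x - y)) * (+ 1 + ρ + ρ)              ∎)

  module _ (M : ℕ) .{{_ : NonZero M}} where

    multiple<⇒≡0 : ∀ k {x} → x ≡ k ℕ.* M → x ℕ.< M → x ≡ 0
    multiple<⇒≡0 zero    x≡0  _   = x≡0
    multiple<⇒≡0 (suc k) refl x<M = contradiction x<M (ℕ.≤⇒≯ (ℕ.m≤m+n M (k ℕ.* M)))

    residue-unique : ∀ {a b} → a ℕ.< M → b ℕ.< M → + a ≡ + b [mod + M ] → a ≡ b
    residue-unique {a} {b} a<M b<M (k , a-b≡kM) =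
      +-injective (i-j≡0⇒i≡j _ _ (∣i∣≡0⇒i≡0 (multiple<⇒≡0 ℤ.∣ k ∣ ∣a-b∣≡∣k∣M ∣a-b∣<M)))
      where
      ∣a-b∣≡∣k∣M : ℤ.∣ + a - + b ∣ ≡ ℤ.∣ k ∣ ℕ.* M
      ∣a-b∣≡∣k∣M = trans (cong ℤ.∣_∣ a-b≡kM) (abs-* k (+ M))
      ∣a-b∣<M : ℤ.∣ + a - + b ∣ ℕ.< M
      ∣a-b∣<M = ℕ.≤-<-trans (subst (λ z → ℤ.∣ z ∣ ℕ.≤ a ℕ.⊔ b) (sym (m-n≡m⊖n a b)) (∣m⊝n∣≤m⊔n a b))
                           (ℕ.⊔-lub a<M b<M)

    %ℕ-mod : ∀ x → x ≡ + (x %ℕ M) [mod + M ]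
    %ℕ-mod x = subst (_≡ + (x %ℕ M) [mod + M ]) (sym (a≡a%ℕn+[a/ℕn]*n x M))
                     (+-multiple-mod (+ (x %ℕ M)) (x /ℕ M))

    %ℕ-≡⇒mod : ∀ {x y} → x %ℕ M ≡ y %ℕ M → x ≡ y [mod + M ]
    %ℕ-≡⇒mod {x} {y} eq =
      mod-trans (%ℕ-mod x) (subst (λ z → + z ≡ y [mod + M ]) (sym eq) (mod-sym (%ℕ-mod y)))

    mod⇒%ℕ-≡ : ∀ {x y} → x ≡ y [mod + M ] → x %ℕ M ≡ y %ℕ M
    mod⇒%ℕ-≡ {x} {y} x≡y = residue-unique (n%ℕd<d x M) (n%ℕd<d y M)
      (mod-trans (mod-sym (%ℕ-mod x)) (mod-trans x≡y (%ℕ-mod y)))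

    +-%ℕ-≢ : ∀ x {d} → 0 ℕ.< d → d ℕ.< M → (x + + d) %ℕ M ≢ x %ℕ M
    +-%ℕ-≢ x {d} 0<d d<M eq = ℕ.<⇒≢ 0<d (sym (residue-unique d<M (ℕ.>-nonZero⁻¹ M)
      (+-cancel-mod x (%ℕ-≡⇒mod eq))))

open Congruence

module _ {A : Set} where

  Apart : A × A → A × A → Set
  Apart (x , y) (x' , y') = x ≢ x' × x ≢ y' × y ≢ x' × y ≢ y'

  SamePair : A × A → A × A → Set
  SamePair (x , y) (x' , y') = (x ≡ x' × y ≡ y') ⊎ (x ≡ y' × y ≡ x')

  Apart-sym : ∀ {e e'} → Apart e e' → Apart e' e
  Apart-sym (x≢x' , x≢y' , y≢x' , y≢y') = ≢-sym x≢x' , ≢-sym y≢x' , ≢-sym x≢y' , ≢-sym y≢y'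

  Apart⇒¬SamePair : ∀ {e e'} → Apart e e' → ¬ SamePair e e'
  Apart⇒¬SamePair (x≢x' , _ , _ , _) (inj₁ (x≡x' , _)) = x≢x' x≡x'
  Apart⇒¬SamePair (_ , x≢y' , _ , _) (inj₂ (x≡y' , _)) = x≢y' x≡y'

sumOfEnds : ∀ {m} → Fin m × Fin m → ℕ
sumOfEnds (x , y) = toℕ x ℕ.+ toℕ y

SamePair⇒sumOfEnds-≡ : ∀ {m} {e e' : Fin m × Fin m} → SamePair e e' → sumOfEnds e ≡ sumOfEnds e'
SamePair⇒sumOfEnds-≡ (inj₁ (refl , refl)) = refl
SamePair⇒sumOfEnds-≡ {e = x , y} (inj₂ (refl , refl)) = ℕ.+-comm (toℕ x) (toℕ y)

module OneFactorisation (r : ℕ) where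
  open import Data.Integer.Base using (_+_; _-_; -_)
  open ℤ-Solver using (solve-∀)

  n M : ℕ
  n = suc r
  M = suc (r ℕ.+ r)

  M<2n : M < 2 ℕ.* n
  M<2n = ℕ.≤-reflexive (2+r+r≡2n r)
    where
    2+r+r≡2n : ∀ r → suc (suc (r ℕ.+ r)) ≡ 2 ℕ.* suc r
    2+r+r≡2n = ℕ-Solver.solve-∀

  %ℕM<2n : ∀ x → x %ℕ M < 2 ℕ.* n
  %ℕM<2n x = ℕ.<-trans (n%ℕd<d x M) M<2n

  ⟦_⟧ : ℤ → Fin (2 ℕ.* n)
  ⟦ x ⟧ = fromℕ< (%ℕM<2n x)

  ∞ : Fin (2 ℕ.* n)
  ∞ = fromℕ< M<2n

  ⟦⟧≢∞ : ∀ x → ⟦ x ⟧ ≢ ∞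
  ⟦⟧≢∞ x eq = ℕ.<⇒≢ (n%ℕd<d x M) (fromℕ<-injective (x %ℕ M) M (%ℕM<2n x) M<2n eq)

  ⟦⟧-≡⇒mod : ∀ {x y} → ⟦ x ⟧ ≡ ⟦ y ⟧ → x ≡ y [mod + M ]
  ⟦⟧-≡⇒mod {x} {y} eq = %ℕ-≡⇒mod M (fromℕ<-injective (x %ℕ M) (y %ℕ M) _ _ eq)

  ⟦⟧-cong : ∀ {x y} → x ≡ y [mod + M ] → ⟦ x ⟧ ≡ ⟦ y ⟧
  ⟦⟧-cong x≡y = fromℕ<-cong _ _ (mod⇒%ℕ-≡ M x≡y) _ _

  toℕ⟦⟧-mod : ∀ x → + toℕ ⟦ x ⟧ ≡ x [mod + M ]
  toℕ⟦⟧-mod x = subst (λ z → + z ≡ x [mod + M ]) (sym (toℕ-fromℕ< _)) (mod-sym (%ℕ-mod M x))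

  ⟦⟧-shift-≢ : ∀ {x} y d → x ≡ y + + d → 0 < d → d ≤ r ℕ.+ r → ⟦ x ⟧ ≢ ⟦ y ⟧
  ⟦⟧-shift-≢ y d refl 0<d d≤2r eq =
    +-%ℕ-≢ M y 0<d (s≤s d≤2r) (fromℕ<-injective ((y + + d) %ℕ M) (y %ℕ M) _ _ eq)

  edge : ℕ → ℕ → Fin (2 ℕ.* n) × Fin (2 ℕ.* n)
  edge i zero    = ⟦ + i ⟧ , ∞
  edge i (suc p) = ⟦ + i + + suc p ⟧ , ⟦ + i - + suc p ⟧

  ≤2r : ∀ {d} → d ≤ r → d ≤ r ℕ.+ r
  ≤2r d≤r = ℕ.≤-trans d≤r (ℕ.m≤m+n r r)

  i+u≡[i-v]+[u+v] : ∀ i u v → i + u ≡ (i - v) + (u + v)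
  i+u≡[i-v]+[u+v] = solve-∀

  edge-distinct : ∀ i {p} → p ≤ r → proj₁ (edge i p) ≢ proj₂ (edge i p)
  edge-distinct i {zero}  _   = ⟦⟧≢∞ (+ i)
  edge-distinct i {suc p} p≤r =
    ⟦⟧-shift-≢ (+ i - + suc p) (suc p ℕ.+ suc p) (i+u≡[i-v]+[u+v] (+ i) (+ suc p) (+ suc p))
               (s≤s z≤n) (ℕ.+-mono-≤ p≤r p≤r)

  edge-apart-same : ∀ i {p q} → p < q → q ≤ r → Apart (edge i p) (edge i q)
  edge-apart-same i {zero} {suc q} _ q≤r =
      ≢-sym (⟦⟧-shift-≢ (+ i) (suc q) refl (s≤s z≤n) (≤2r q≤r))
    , ⟦⟧-shift-≢ (+ i - + suc q) (suc q) (i≡[i-u]+u (+ i) (+ suc q)) (s≤s z≤n) (≤2r q≤r)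
    , ≢-sym (⟦⟧≢∞ (+ i + + suc q))
    , ≢-sym (⟦⟧≢∞ (+ i - + suc q))
    where
    i≡[i-u]+u : ∀ i u → i ≡ (i - u) + u
    i≡[i-u]+u = solve-∀
  edge-apart-same i {suc p} p<q q≤r with ℕ.m≤n⇒∃[o]m+o≡n p<q
  ... | a , refl =
      ≢-sym (⟦⟧-shift-≢ (+ i + + suc p) (suc a) (i+[1+u+a]≡[i+u]+[1+a] (+ i) (+ suc p) (+ a))
                        (s≤s z≤n) (≤2r 1+a≤r))
    , ⟦⟧-shift-≢ (+ i - + q) (suc p ℕ.+ q) (i+u≡[i-v]+[u+v] (+ i) (+ suc p) (+ q))
                 (s≤s z≤n) (ℕ.+-mono-≤ 1+p≤r q≤r)
    , ≢-sym (⟦⟧-shift-≢ (+ i - + suc p) (q ℕ.+ suc p) (i+u≡[i-v]+[u+v] (+ i) (+ q) (+ suc p))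
                        (s≤s z≤n) (ℕ.+-mono-≤ q≤r 1+p≤r))
    , ⟦⟧-shift-≢ (+ i - + q) (suc a) (i-u≡[i-[1+u+a]]+[1+a] (+ i) (+ suc p) (+ a))
                 (s≤s z≤n) (≤2r 1+a≤r)
    where
    q = suc (suc p ℕ.+ a)
    1+p≤r : suc p ≤ r
    1+p≤r = ℕ.<⇒≤ (ℕ.<-≤-trans p<q q≤r)
    1+a≤r : suc a ≤ r
    1+a≤r = ℕ.≤-trans (s≤s (ℕ.m≤n+m a (suc p))) q≤r
    i+[1+u+a]≡[i+u]+[1+a] : ∀ i u a → i + (+ 1 + u + a) ≡ (i + u) + (+ 1 + a)
    i+[1+u+a]≡[i+u]+[1+a] = solve-∀
    i-u≡[i-[1+u+a]]+[1+a] : ∀ i u a → i - u ≡ (i - (+ 1 + u + a)) + (+ 1 + a)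
    i-u≡[i-[1+u+a]]+[1+a] = solve-∀

  edge-apart-next : ∀ i {p q} → 2 ℕ.+ q ≤ p → p ≤ r → Apart (edge i p) (edge (suc i) q)
  edge-apart-next i {q = zero} 2≤p p≤r with ℕ.m≤n⇒∃[o]m+o≡n 2≤p
  ... | a , refl =
      ⟦⟧-shift-≢ (+ suc i) (suc a) (i+[2+a]≡[1+i]+[1+a] (+ i) (+ a)) (s≤s z≤n) (≤2r (ℕ.<⇒≤ p≤r))
    , ⟦⟧≢∞ (+ i + + p)
    , ≢-sym (⟦⟧-shift-≢ (+ i - + p) (suc p) (1+i≡[i-[2+a]]+[3+a] (+ i) (+ a)) (s≤s z≤n) 1+p≤2r)
    , ⟦⟧≢∞ (+ i - + p)
    where
    p = suc (suc a)
    1+p≤2r : suc p ≤ r ℕ.+ r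
    1+p≤2r = ℕ.+-mono-≤ (ℕ.≤-trans (s≤s z≤n) p≤r) p≤r
    i+[2+a]≡[1+i]+[1+a] : ∀ i a → i + (+ 2 + a) ≡ (+ 1 + i) + (+ 1 + a)
    i+[2+a]≡[1+i]+[1+a] = solve-∀
    1+i≡[i-[2+a]]+[3+a] : ∀ i a → + 1 + i ≡ (i - (+ 2 + a)) + (+ 3 + a)
    1+i≡[i-[2+a]]+[3+a] = solve-∀
  edge-apart-next i {q = suc q} 2+q≤p p≤r with ℕ.m≤n⇒∃[o]m+o≡n 2+q≤p
  ... | a , refl =
      ⟦⟧-shift-≢ (+ suc i + + Q) (suc a) (i+[2+u+a]≡[1+i+u]+[1+a] (+ i) (+ Q) (+ a))
                 (s≤s z≤n) (≤2r (≤p⇒≤r 1+a≤p))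
    , ⟦⟧-shift-≢ (+ suc i - + Q) (suc (Q ℕ.+ a) ℕ.+ Q) (i+[2+u+a]≡[1+i-u]+[1+u+a+u] (+ i) (+ Q) (+ a))
                 (s≤s z≤n) (ℕ.+-mono-≤ (≤p⇒≤r (ℕ.n≤1+n _)) (ℕ.<⇒≤ 1+Q≤r))
    , ≢-sym (⟦⟧-shift-≢ (+ i - + p) (p ℕ.+ suc Q) (1+i+u≡[i-[2+u+a]]+[2+u+a+1+u] (+ i) (+ Q) (+ a))
                        (s≤s z≤n) (ℕ.+-mono-≤ p≤r 1+Q≤r))
    , ≢-sym (⟦⟧-shift-≢ (+ i - + p) (3 ℕ.+ a) (1+i-u≡[i-[2+u+a]]+[3+a] (+ i) (+ Q) (+ a))
                        (s≤s z≤n) (≤2r (≤p⇒≤r (s≤s (s≤s (s≤s (ℕ.m≤n+m a q)))))))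
    where
    Q = suc q
    p = suc (suc (Q ℕ.+ a))
    ≤p⇒≤r : ∀ {d} → d ≤ p → d ≤ r
    ≤p⇒≤r d≤p = ℕ.≤-trans d≤p p≤r
    1+a≤p : suc a ≤ p
    1+a≤p = s≤s (ℕ.m≤n+m a (suc Q))
    1+Q≤r : suc Q ≤ r
    1+Q≤r = ≤p⇒≤r (s≤s (ℕ.≤-trans (ℕ.m≤m+n Q a) (ℕ.n≤1+n _)))
    i+[2+u+a]≡[1+i+u]+[1+a] : ∀ i u a → i + (+ 2 + u + a) ≡ (+ 1 + i + u) + (+ 1 + a)
    i+[2+u+a]≡[1+i+u]+[1+a] = solve-∀
    i+[2+u+a]≡[1+i-u]+[1+u+a+u] : ∀ i u a → i + (+ 2 + u + a) ≡ (+ 1 + i - u) + ((+ 1 + u + a) + u)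
    i+[2+u+a]≡[1+i-u]+[1+u+a+u] = solve-∀
    1+i+u≡[i-[2+u+a]]+[2+u+a+1+u] : ∀ i u a → + 1 + i + u ≡ (i - (+ 2 + u + a)) + ((+ 2 + u + a) + (+ 1 + u))
    1+i+u≡[i-[2+u+a]]+[2+u+a+1+u] = solve-∀
    1+i-u≡[i-[2+u+a]]+[3+a] : ∀ i u a → + 1 + i - u ≡ (i - (+ 2 + u + a)) + (+ 3 + a)
    1+i-u≡[i-[2+u+a]]+[3+a] = solve-∀

  edge-periodic : ∀ i p → edge (i ℕ.+ M) p ≡ edge i p
  edge-periodic i zero    = cong (_, ∞) (⟦⟧-cong (+m-mod (+ i)))
  edge-periodic i (suc p) = cong₂ _,_ (⟦⟧-cong (mod-+ (+m-mod (+ i)) (mod-refl (+ suc p))))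
                                      (⟦⟧-cong (mod-+ (+m-mod (+ i)) (mod-refl (- + suc p))))

  edge-sum-mod : ∀ i p → + sumOfEnds (edge i (suc p)) ≡ + i + + i [mod + M ]
  edge-sum-mod i p = mod-trans (mod-+ (toℕ⟦⟧-mod (+ i + + suc p)) (toℕ⟦⟧-mod (+ i - + suc p)))
                                (mod-reflexive ([i+u]+[i-u]≡i+i (+ i) (+ suc p)))
    where
    [i+u]+[i-u]≡i+i : ∀ i u → (i + u) + (i - u) ≡ i + i
    [i+u]+[i-u]≡i+i = solve-∀

  edge-matching-unique : ∀ {i j p q} → i < M → j < M → SamePair (edge i p) (edge j q) → i ≡ j
  edge-matching-unique {i} {j} {zero}  {zero}  i<M j<M (inj₁ (⟦i⟧≡⟦j⟧ , _)) =
    residue-unique M i<M j<M (⟦⟧-≡⇒mod ⟦i⟧≡⟦j⟧)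
  edge-matching-unique {i} {j} {zero}  {zero}  _ _ (inj₂ (⟦i⟧≡∞ , _)) =
    contradiction ⟦i⟧≡∞ (⟦⟧≢∞ (+ i))
  edge-matching-unique {j = j} {zero}  {suc q} _ _ (inj₁ (_ , ∞≡y)) =
    contradiction (sym ∞≡y) (⟦⟧≢∞ (+ j - + suc q))
  edge-matching-unique {j = j} {zero}  {suc q} _ _ (inj₂ (_ , ∞≡x)) =
    contradiction (sym ∞≡x) (⟦⟧≢∞ (+ j + + suc q))
  edge-matching-unique {i} {p = suc p} {zero}  _ _ (inj₁ (_ , y≡∞)) =
    contradiction y≡∞ (⟦⟧≢∞ (+ i - + suc p))
  edge-matching-unique {i} {p = suc p} {zero}  _ _ (inj₂ (x≡∞ , _)) =
    contradiction x≡∞ (⟦⟧≢∞ (+ i + + suc p))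
  edge-matching-unique {i} {j} {suc p} {suc q} i<M j<M same =
    residue-unique M i<M j<M (halve-mod (+ r) doubled-matching)
    where
    doubled-matching : + i + + i ≡ + j + + j [mod + M ]
    doubled-matching = mod-trans (mod-sym (edge-sum-mod i p))
      (subst (λ s → + s ≡ + j + + j [mod + M ]) (sym (SamePair⇒sumOfEnds-≡ same)) (edge-sum-mod j q))

  edge-injective : ∀ {i j p q} → i < M → j < M → p ≤ r → q ≤ r →
                   SamePair (edge i p) (edge j q) → i ≡ j × p ≡ q
  edge-injective {i} {p = p} {q} i<M j<M p≤r q≤r same
    with edge-matching-unique {p = p} {q} i<M j<M same
  ... | refl = refl , sameOffset (ℕ.<-cmp p q)
    where
    sameOffset : Tri (p < q) (p ≡ q) (q < p) → p ≡ q
    sameOffset (tri< p<q _ _) = contradiction same (Apart⇒¬SamePair (edge-apart-same i p<q q≤r))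
    sameOffset (tri≈ _ p≡q _) = p≡q
    sameOffset (tri> _ _ q<p) =
      contradiction same (Apart⇒¬SamePair (Apart-sym (edge-apart-same i q<p p≤r)))

open import Data.Nat using (_+_; _*_; _∸_; _⊓_)
open import Data.Vec using (_∷_; [])
open import Algebra.Properties.CommutativeSemigroup ℕ.+-commutativeSemigroup using (xy∙z≈xz∙y; xy∙z≈y∙xz; x∙yz≈y∙xz)

∣⁅x⁆∪⁅y⁆∣≡2 : ∀ {m} {x y : Fin m} → x ≢ y → ∣ ⁅ x ⁆ ∪ ⁅ y ⁆ ∣ ≡ 2
∣⁅x⁆∪⁅y⁆∣≡2 {x = zero}  {zero}  x≢y = contradiction refl x≢y
∣⁅x⁆∪⁅y⁆∣≡2 {x = zero}  {suc y} _   = cong suc (trans (cong ∣_∣ (∪-identityˡ ⁅ y ⁆)) (∣⁅x⁆∣≡1 y))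
∣⁅x⁆∪⁅y⁆∣≡2 {x = suc x} {zero}  _   = cong suc (trans (cong ∣_∣ (∪-identityʳ ⁅ x ⁆)) (∣⁅x⁆∣≡1 x))
∣⁅x⁆∪⁅y⁆∣≡2 {x = suc x} {suc y} x≢y = ∣⁅x⁆∪⁅y⁆∣≡2 (x≢y ∘ cong suc)

module _ {m : ℕ} where

  pair : (e : Fin m × Fin m) → proj₁ e ≢ proj₂ e → KneserVertex m 2
  pair (x , y) x≢y = ⁅ x ⁆ ∪ ⁅ y ⁆ , ∣⁅x⁆∪⁅y⁆∣≡2 x≢y

  ∈-pair⁻ : ∀ {x y z : Fin m} → z ∈ ⁅ x ⁆ ∪ ⁅ y ⁆ → z ≡ x ⊎ z ≡ y
  ∈-pair⁻ {x} {y} z∈ with x∈p∪q⁻ ⁅ x ⁆ ⁅ y ⁆ z∈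
  ... | inj₁ z∈⁅x⁆ = inj₁ (x∈⁅y⁆⇒x≡y x z∈⁅x⁆)
  ... | inj₂ z∈⁅y⁆ = inj₂ (x∈⁅y⁆⇒x≡y y z∈⁅y⁆)

  pair-cong : ∀ {e e'} {x≢y : proj₁ e ≢ proj₂ e} {x'≢y' : proj₁ e' ≢ proj₂ e'} →
              e ≡ e' → pair e x≢y ≡ pair e' x'≢y'
  pair-cong {x , y} refl = cong (⁅ x ⁆ ∪ ⁅ y ⁆ ,_) (ℕ.≡-irrelevant _ _)

  pair-adjacent : ∀ e e' {x≢y : proj₁ e ≢ proj₂ e} {x'≢y' : proj₁ e' ≢ proj₂ e'} →
                  Apart e e' → KneserAdj (pair e x≢y) (pair e' x'≢y')
  pair-adjacent (x , y) (x' , y') (x≢x' , x≢y' , y≢x' , y≢y') (z , z∈∩)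
    with x∈p∩q⁻ (⁅ x ⁆ ∪ ⁅ y ⁆) (⁅ x' ⁆ ∪ ⁅ y' ⁆) z∈∩
  ... | z∈e , z∈e' with ∈-pair⁻ z∈e | ∈-pair⁻ z∈e'
  ... | inj₁ refl | inj₁ refl = x≢x' refl
  ... | inj₁ refl | inj₂ refl = x≢y' refl
  ... | inj₂ refl | inj₁ refl = y≢x' refl
  ... | inj₂ refl | inj₂ refl = y≢y' refl

  pair-injective : ∀ e e' {x≢y : proj₁ e ≢ proj₂ e} {x'≢y' : proj₁ e' ≢ proj₂ e'} →
                   pair e x≢y ≡ pair e' x'≢y' → SamePair e e'
  pair-injective (x , y) _ {x≢y} eq
    with ∈-pair⁻ (subst (x ∈_) (cong proj₁ eq) (x∈p∪q⁺ (inj₁ (x∈⁅x⁆ x))))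
       | ∈-pair⁻ (subst (y ∈_) (cong proj₁ eq) (x∈p∪q⁺ (inj₂ (x∈⁅x⁆ y))))
  ... | inj₁ x≡x' | inj₂ y≡y' = inj₁ (x≡x' , y≡y')
  ... | inj₂ x≡y' | inj₁ y≡x' = inj₂ (x≡y' , y≡x')
  ... | inj₁ refl | inj₁ refl = contradiction refl x≢y
  ... | inj₂ refl | inj₂ refl = contradiction refl x≢y

KneserAdj-sym : ∀ {m s} (A B : KneserVertex m s) → KneserAdj A B → KneserAdj B A
KneserAdj-sym (A , _) (B , _) = subst Empty (∩-comm A B)

binomial : ℕ → ℕ → ℕ
binomial m       zero    = 1
binomial zero    (suc k) = 0
binomial (suc m) (suc k) = binomial m (suc k) + binomial m k

binomial-1 : ∀ m → binomial m 1 ≡ m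
binomial-1 zero    = refl
binomial-1 (suc m) = trans (cong (_+ 1) (binomial-1 m)) (ℕ.+-comm m 1)

binomial-2 : ∀ m → binomial (suc m) 2 * 2 ≡ suc m * m
binomial-2 zero    = refl
binomial-2 (suc m) = begin
  (binomial (suc m) 2 + binomial (suc m) 1) * 2 ≡⟨ cong (λ b → (binomial (suc m) 2 + b) * 2) (binomial-1 (suc m)) ⟩
  (binomial (suc m) 2 + suc m) * 2             ≡⟨ ℕ.*-distribʳ-+ 2 (binomial (suc m) 2) (suc m) ⟩
  binomial (suc m) 2 * 2 + suc m * 2           ≡⟨ cong (_+ suc m * 2) (binomial-2 m) ⟩
  suc m * m + suc m * 2                         ≡⟨ distrib m ⟩
  suc (suc m) * suc m                           ∎
  where
  open ≡-Reasoning
  distrib : ∀ m → suc m * m + suc m * 2 ≡ suc (suc m) * suc m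
  distrib = ℕ-Solver.solve-∀

-- The two summands of Pascal's rule count the k-subsets without and with the first point.
subsetIndex : ∀ m k → KneserVertex m k → Fin (binomial m k)
subsetIndex m       zero    _                = zero
subsetIndex zero    (suc k) ([] , ())
subsetIndex (suc m) (suc k) (outside ∷ A , ∣A∣≡) = subsetIndex m (suc k) (A , ∣A∣≡) ↑ˡ binomial m k
subsetIndex (suc m) (suc k) (inside ∷ A , ∣A∣≡)  = binomial m (suc k) ↑ʳ subsetIndex m k (A , ℕ.suc-injective ∣A∣≡)

↑ˡ≢↑ʳ : ∀ {a b} (i : Fin a) (j : Fin b) → i ↑ˡ b ≢ a ↑ʳ j
↑ˡ≢↑ʳ {a} {b} i j eq with trans (sym (splitAt-↑ˡ a i b)) (trans (cong (splitAt a) eq) (splitAt-↑ʳ a b j))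
... | ()

KneserVertex-≡ : ∀ {m k} {A B : KneserVertex m k} → proj₁ A ≡ proj₁ B → A ≡ B
KneserVertex-≡ {A = A , _} refl = cong (A ,_) (ℕ.≡-irrelevant _ _)

subsetIndex-injective : ∀ m k {A B : KneserVertex m k} →
                        subsetIndex m k A ≡ subsetIndex m k B → proj₁ A ≡ proj₁ B
subsetIndex-injective zero    zero    {[] , _} {[] , _} _ = refl
subsetIndex-injective (suc m) zero    {outside ∷ A , ∣A∣≡0} {outside ∷ B , ∣B∣≡0} _ =
  cong (outside ∷_) (subsetIndex-injective m zero {A , ∣A∣≡0} {B , ∣B∣≡0} refl)
subsetIndex-injective (suc m) (suc k) {outside ∷ A , ∣A∣≡} {outside ∷ B , ∣B∣≡} eq =
  cong (outside ∷_) (subsetIndex-injective m (suc k) {A , ∣A∣≡} {B , ∣B∣≡} (↑ˡ-injective _ _ _ eq))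
subsetIndex-injective (suc m) (suc k) {outside ∷ A , _} {inside ∷ B , _}  eq = contradiction eq (↑ˡ≢↑ʳ _ _)
subsetIndex-injective (suc m) (suc k) {inside ∷ A , _}  {outside ∷ B , _} eq = contradiction (sym eq) (↑ˡ≢↑ʳ _ _)
subsetIndex-injective (suc m) (suc k) {inside ∷ A , ∣A∣≡}  {inside ∷ B , ∣B∣≡}  eq =
  cong (inside ∷_) (subsetIndex-injective m k {A , ℕ.suc-injective ∣A∣≡} {B , ℕ.suc-injective ∣B∣≡}
                                           (↑ʳ-injective _ _ _ eq))

KneserVertex↣Fin : ∀ m k → KneserVertex m k ↣ Fin (binomial m k)
KneserVertex↣Fin m k = mk↣ {to = subsetIndex m k} (KneserVertex-≡ ∘ subsetIndex-injective m k)

Fin-injective⇒surjective : ∀ {N} {f : Fin N → Fin N} → Injective _≡_ _≡_ f → StrictlySurjective _≡_ f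
Fin-injective⇒surjective {suc N} {f} f-injective y with any? (λ x → f x ≟ y)
... | yes hit  = hit
... | no  miss = contradiction (injective⇒≤ missing-injective) ℕ.1+n≰n
  where
  missing : Fin (suc N) → Fin N
  missing x = punchOut {i = y} {j = f x} (miss ∘ (x ,_) ∘ sym)
  missing-injective : Injective _≡_ _≡_ missing
  missing-injective = f-injective ∘ punchOut-injective {i = y} _ _

Fin↣-bijection : ∀ {N} {A : Set} (f : Fin N ↣ A) → A ↣ Fin N → Fin N ⤖ A
Fin↣-bijection f g = mk⤖ (Injection.injective f , surjective)
  where
  g∘f-surjective : StrictlySurjective _≡_ (Injection.to g ∘ Injection.to f)
  g∘f-surjective = Fin-injective⇒surjective (Injection.injective f ∘ Injection.injective g)
  surjective : ∀ a → ∃ λ x → ∀ {z} → z ≡ x → Injection.to f z ≡ a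
  surjective a with g∘f-surjective (Injection.to g a)
  ... | x , gfx≡ga = x , λ { refl → Injection.injective g gfx≡ga }

cyclicSequence⇒ContainsHamCyclePower :
  ∀ {V : Set} {Adj : V → V → Set} {k} N (v : ℕ → V) →
  (∀ x y → Adj x y → Adj y x) →
  (∀ u → v (u + N) ≡ v u) →
  (∀ u d → 0 < d → d ≤ k → Adj (v u) (v (u + d))) →
  (∀ {u w} → u < N → w < N → v u ≡ v w → u ≡ w) →
  V ↣ Fin N →
  ContainsHamCyclePower V Adj k
cyclicSequence⇒ContainsHamCyclePower {V} {Adj} {k} N v Adj-sym v-periodic v-adjacent v-injective V↣Fin =
  N , Fin↣-bijection enumeration V↣Fin , λ i j → adjacent-in-cycle (toℕ<n j)
  where
  enumeration : Fin N ↣ V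
  enumeration = mk↣ {to = v ∘ toℕ} (toℕ-injective ∘ v-injective (toℕ<n _) (toℕ<n _))

  adjacent-in-cycle : ∀ {a b} → b < N → a < b → (b ∸ a) ⊓ (a + N ∸ b) ≤ k → Adj (v a) (v b)
  adjacent-in-cycle {a} {b} b<N a<b dist≤k with ℕ.≤-total (b ∸ a) (a + N ∸ b)
  ... | inj₁ forward = subst (Adj (v a) ∘ v) (ℕ.m+[n∸m]≡n (ℕ.<⇒≤ a<b))
          (v-adjacent a (b ∸ a) (ℕ.m<n⇒0<n∸m a<b) (subst (_≤ k) (ℕ.m≤n⇒m⊓n≡m forward) dist≤k))
  ... | inj₂ backward = Adj-sym (v b) (v a) (subst (Adj (v b)) v[b+[a+N∸b]]≡v[a]
          (v-adjacent b (a + N ∸ b) (ℕ.m<n⇒0<n∸m b<a+N) (subst (_≤ k) (ℕ.m≥n⇒m⊓n≡n backward) dist≤k)))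
    where
    b<a+N : b < a + N
    b<a+N = ℕ.<-≤-trans b<N (ℕ.m≤n+m N a)
    v[b+[a+N∸b]]≡v[a] : v (b + (a + N ∸ b)) ≡ v a
    v[b+[a+N∸b]]≡v[a] = trans (cong v (ℕ.m+[n∸m]≡n (ℕ.<⇒≤ b<a+N))) (v-periodic a)

module Enumeration (r : ℕ) where
  open OneFactorisation r

  edgeAt : ℕ → Fin (2 * n) × Fin (2 * n)
  edgeAt u = edge (u / n) (u % n)

  offset≤r : ∀ u → u % n ≤ r
  offset≤r u = ℕ.≤-pred (m%n<n u n)

  edgeAt-block : ∀ i {p} → p < n → edgeAt (p + i * n) ≡ edge i p
  edgeAt-block i {p} p<n = cong₂ edge quotient remainder
    where
    remainder : (p + i * n) % n ≡ p
    remainder = trans ([m+kn]%n≡m%n p i n) (m<n⇒m%n≡m p<n)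
    quotient : (p + i * n) / n ≡ i
    quotient = trans (+-distrib-/-∣ʳ p (n∣m*n i)) (cong₂ _+_ (m<n⇒m/n≡0 p<n) (m*n/n≡m i n))

  edgeAt-periodic : ∀ u → edgeAt (u + M * n) ≡ edgeAt u
  edgeAt-periodic u = begin
    edgeAt (u + M * n)        ≡⟨ cong (λ v → edgeAt (v + M * n)) (m≡m%n+[m/n]*n u n) ⟩
    edgeAt (p + i * n + M * n) ≡⟨ cong edgeAt (shift p i M n) ⟩
    edgeAt (p + (i + M) * n)  ≡⟨ edgeAt-block (i + M) (m%n<n u n) ⟩
    edge (i + M) p            ≡⟨ edge-periodic i p ⟩
    edge i p                  ∎
    where
    open ≡-Reasoning
    p = u % n
    i = u / n
    shift : ∀ p i m n → p + i * n + m * n ≡ p + (i + m) * n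
    shift = ℕ-Solver.solve-∀

  edgeAt-apart : ∀ u {d} → 0 < d → suc d ≤ r → Apart (edgeAt u) (edgeAt (u + d))
  edgeAt-apart u {d} 0<d 1+d≤r = split-on-carry (p + d ℕ.<? n)
    where
    p = u % n
    i = u / n
    p<n : p < n
    p<n = m%n<n u n
    u+d≡[p+d]+in : u + d ≡ (p + d) + i * n
    u+d≡[p+d]+in = trans (cong (_+ d) (m≡m%n+[m/n]*n u n)) (xy∙z≈xz∙y p (i * n) d)

    split-on-carry : Dec (p + d < n) → Apart (edge i p) (edgeAt (u + d))
    split-on-carry (yes p+d<n) =
      subst (Apart (edge i p)) (sym (trans (cong edgeAt u+d≡[p+d]+in) (edgeAt-block i p+d<n)))
            (edge-apart-same i (ℕ.m<m+n p 0<d) (ℕ.≤-pred p+d<n))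
    split-on-carry (no p+d≮n) with ℕ.m≤n⇒∃[o]m+o≡n (ℕ.≮⇒≥ p+d≮n)
    ... | q , n+q≡p+d =
      subst (Apart (edge i p)) (sym (trans (cong edgeAt u+d≡q+[1+i]n) (edgeAt-block (suc i) q<n)))
            (edge-apart-next i 2+q≤p (offset≤r u))
      where
      u+d≡q+[1+i]n : u + d ≡ q + suc i * n
      u+d≡q+[1+i]n = trans u+d≡[p+d]+in (trans (cong (_+ i * n) (sym n+q≡p+d)) (xy∙z≈y∙xz n q (i * n)))
      d<n : d < n
      d<n = ℕ.<-trans (ℕ.n<1+n d) (s≤s 1+d≤r)
      q<n : q < n
      q<n = ℕ.+-cancelˡ-< n q n (subst (_< n + n) (sym n+q≡p+d) (ℕ.+-mono-< p<n d<n))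
      2+q≤p : 2 + q ≤ p
      2+q≤p = ℕ.+-cancelˡ-≤ n (2 + q) p (begin
        n + (2 + q)  ≡⟨ x∙yz≈y∙xz n 2 q ⟩
        2 + (n + q)  ≡⟨ cong (λ m → 2 + m) n+q≡p+d ⟩
        2 + (p + d)  ≡⟨ x∙yz≈y∙xz 2 p d ⟩
        p + (2 + d)  ≤⟨ ℕ.+-monoʳ-≤ p (s≤s 1+d≤r) ⟩
        p + n        ≡⟨ ℕ.+-comm p n ⟩
        n + p        ∎)
        where open ℕ.≤-Reasoning

  edgeAt-distinct : ∀ u → proj₁ (edgeAt u) ≢ proj₂ (edgeAt u)
  edgeAt-distinct u = edge-distinct (u / n) (offset≤r u)

  vertexAt : ℕ → KneserVertex (2 * n) 2
  vertexAt u = pair (edgeAt u) (edgeAt-distinct u)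

  vertexAt-periodic : ∀ u → vertexAt (u + M * n) ≡ vertexAt u
  vertexAt-periodic u = pair-cong (edgeAt-periodic u)

  vertexAt-adjacent : ∀ u {d} → 0 < d → suc d ≤ r → KneserAdj (vertexAt u) (vertexAt (u + d))
  vertexAt-adjacent u {d} 0<d 1+d≤r =
    pair-adjacent (edgeAt u) (edgeAt (u + d)) {edgeAt-distinct u} {edgeAt-distinct (u + d)}
                  (edgeAt-apart u 0<d 1+d≤r)

  vertexAt-injective : ∀ {u w} → u < M * n → w < M * n → vertexAt u ≡ vertexAt w → u ≡ w
  vertexAt-injective {u} {w} u<Mn w<Mn eq
    with edge-injective (m<n*o⇒m/o<n u<Mn) (m<n*o⇒m/o<n w<Mn) (offset≤r u) (offset≤r w)
                        (pair-injective (edgeAt u) (edgeAt w) eq)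
  ... | i≡ , p≡ = begin
    u                  ≡⟨ m≡m%n+[m/n]*n u n ⟩
    u % n + u / n * n  ≡⟨ cong₂ (λ p i → p + i * n) p≡ i≡ ⟩
    w % n + w / n * n  ≡⟨ m≡m%n+[m/n]*n w n ⟨
    w                  ∎
    where open ≡-Reasoning

  binomial-2n≡Mn : binomial (2 * n) 2 ≡ M * n
  binomial-2n≡Mn = ℕ.*-cancelʳ-≡ _ _ 2 (trans (binomial-2 (r + suc (r + 0))) (2n[2n∸1]≡Mn*2 r))
    where
    -- 2 * suc r unfolds to suc (r + suc (r + 0)), which is the shape binomial-2 needs.
    2n[2n∸1]≡Mn*2 : ∀ r → suc (r + suc (r + 0)) * (r + suc (r + 0)) ≡ suc (r + r) * suc r * 2
    2n[2n∸1]≡Mn*2 = ℕ-Solver.solve-∀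

m≤n∸1⇒m<n : ∀ {m n} → 0 < m → m ≤ n ∸ 1 → m < n
m≤n∸1⇒m<n {n = zero}  0<m m≤0 = contradiction (ℕ.<-≤-trans 0<m m≤0) (λ ())
m≤n∸1⇒m<n {n = suc n} _   m≤n = s≤s m≤n

corollary5 : ∀ (n : ℕ) → 1 ≤ n → ∀ (k : ℕ) → 1 ≤ k → k ≤ n ∸ 2 →
    ContainsHamCyclePower (KneserVertex (2 * n) 2) KneserAdj k
corollary5 (suc r) _ k _ k≤r∸1 =
  cyclicSequence⇒ContainsHamCyclePower (M * n) vertexAt KneserAdj-sym vertexAt-periodic
    (λ u d 0<d d≤k → vertexAt-adjacent u 0<d (m≤n∸1⇒m<n 0<d (ℕ.≤-trans d≤k k≤r∸1)))
    vertexAt-injective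
    (subst (λ N → KneserVertex (2 * n) 2 ↣ Fin N) binomial-2n≡Mn (KneserVertex↣Fin (2 * n) 2))
  where
  open OneFactorisation r using (n; M)
  open Enumeration r
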